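{- Let $n\ge 3$ and let $P(G(n))$ be the power graph of the gyrogroup $(G(n),\oplus)$ described in the context. Then the metric dimension of $P(G(n))$ is $\psi(P(G(n)))=2^n-3$.
   Context: Let $n\ge 3$ and $m=2^{n-1}$. Put $P(n)=\{0,1,\dots,m-1\}$, $H(n)=\{m,m+1,\dots,2^n-1\}$ and $G(n)=P(n)\cup H(n)$. Define a binary operation $\oplus$ on $G(n)$ by: $i\oplus j=t$ if $(i,j)\in P(n)\times P(n)$; $i\oplus j=t+m$ if $(i,j)\in P(n)\times H(n)$; $i\oplus j=s+m$ if $(i,j)\in H(n)\times P(n)$; $i\oplus j=k$ if $(i,j)\in H(n)\times H(n)$, where $t,s,k\in P(n)$ are determined by $t\equiv i+j$, $s\equiv i+(\tfrac m2-1)j$, $k\equiv(\tfrac m2+1)i+(\tfrac m2-1)j \pmod m$. Then $(G(n),\oplus)$ is a gyrogroup with identity $e=0$. Powers are defined by $a^1=a$, $a^{k+1}=a\oplus a^k$. The power graph $P(G(n))$ is the simple undirected graph with vertex set $G(n)$ in which two distinct vertices $u,v$ are adjacent if and only if $u^k=v$ or $v^k=u$ for some positive integer $k$. For a connected graph $G$ with shortest-path distance $d$ and an ordered set $U=\{u_1,\dots,u_s\}\subseteq V(G)$, the representation of $v$ is $r(v|U)=(d(v,u_1),\dots,d(v,u_s))$; $U$ is a resolving set if distinct vertices have distinct representations. The metric dimension $\psi(G)$ is the minimum cardinality of a resolving set. -}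

module Defs where

open import Data.Nat using (ℕ; zero; suc; _+_; _*_; _∸_; _^_; _≤_; _<_; _<ᵇ_)
open import Data.Nat.DivMod using (_%_)
open import Data.Bool using (Bool; true; false)
open import Data.Fin using (Fin; toℕ)
open import Data.Fin.Subset using (Subset; _∈_; ∣_∣)
open import Data.Product using (_×_; ∃-syntax; Σ-syntax)
open import Data.Sum using (_⊎_)
open import Relation.Nullary using (¬_)
open import Relation.Binary.PropositionalEquality using (_≡_)

-- The gyrogroup G(n) = {0, …, 2^n - 1}, with m = 2^(n-1).
-- The operation is defined on ℕ; on inputs < 2^n it is exactly the
-- paper's ⊕ (congruences mod m are insensitive to subtracting m).

half : ℕ → ℕ
half n = 2 ^ (n ∸ 1)

quarter : ℕ → ℕ
quarter n = 2 ^ (n ∸ 2)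

gyroOp : (n : ℕ) → ℕ → ℕ → ℕ
gyroOp n i j = go (i <ᵇ m) (j <ᵇ m)
  where
  m : ℕ
  m = 2 ^ (n ∸ 1)
  md : ℕ → ℕ
  md x = x % (suc (m ∸ 1))   -- = x mod m, since m ≥ 1
  t s k : ℕ
  t = md (i + j)
  s = md (i + (quarter n ∸ 1) * j)
  k = md ((quarter n + 1) * i + (quarter n ∸ 1) * j)
  go : Bool → Bool → ℕ
  go true  true  = t
  go true  false = t + m
  go false true  = s + m
  go false false = k

-- powers: a^1 = a, a^(k+1) = a ⊕ a^k ; gyroPow n k a = a^(k+1)
gyroPow : (n : ℕ) → ℕ → ℕ → ℕ
gyroPow n zero    a = a
gyroPow n (suc k) a = gyroOp n a (gyroPow n k a)

PowerAdj : (n : ℕ) → Fin (2 ^ n) → Fin (2 ^ n) → Set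
PowerAdj n u v =
  ¬ (u ≡ v) ×
  ∃[ k ] (gyroPow n k (toℕ u) ≡ toℕ v ⊎ gyroPow n k (toℕ v) ≡ toℕ u)

module Graph {N : ℕ} (Adj : Fin N → Fin N → Set) where

  data Walk : Fin N → Fin N → ℕ → Set where
    nil  : ∀ {u} → Walk u u 0
    cons : ∀ {u w v k} → Adj u w → Walk w v k → Walk u v (suc k)

  Dist : Fin N → Fin N → ℕ → Set
  Dist u v k = Walk u v k × (∀ j → Walk u v j → k ≤ j)

  SameRep : Subset N → Fin N → Fin N → Set
  SameRep U v w = ∀ u → u ∈ U → ∀ k → (Dist v u k → Dist w u k) × (Dist w u k → Dist v u k)

  Resolving : Subset N → Set
  Resolving U = ∀ v w → SameRep U v w → v ≡ w

  MetricDim : ℕ → Set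
  MetricDim d = (Σ[ U ∈ Subset N ] (Resolving U × ∣ U ∣ ≡ d))
              × (∀ U → Resolving U → d ≤ ∣ U ∣)

{-# OPTIONS --safe #-}
-- In the power graph of G(n) the identity 0 is adjacent to every vertex, the non-zero elements
-- of the cyclic group P(n) ≅ ℤ/m form a clique (of two elements of a cyclic 2-group one is a
-- multiple of the other), and every h ∈ H(n) is a pendant vertex at 0, because h ⊕ h = 0 and
-- h ⊕ 0 = h. Two vertices of P(n) ∖ {0}, or two of H(n), are therefore twins, so a resolving
-- set misses at most 0, one vertex of P(n) and one of H(n). Conversely, the complement of
-- {0, 2, m + 1} is resolving: the distances to 1 and to m already separate those three.
module Submission where

open import Defs
open import Data.Nat
open import Data.Nat.Properties
open import Data.Nat.DivMod
open import Data.Nat.Tactic.RingSolver using (solve-∀)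
open import Data.Bool using (true; false)
open import Data.Bool.Properties using (T-≡; ¬-not)
open import Data.Empty using (⊥-elim)
open import Data.Fin using (Fin; toℕ; fromℕ<)
open import Data.Fin.Properties using (toℕ-injective; toℕ-fromℕ<; toℕ<n; fromℕ<-injective; any?)
open import Data.Fin.Patterns using (0F; 1F; 2F)
open import Data.Fin.Subset using (Subset; _∈_; _∉_; ∣_∣; ⁅_⁆; _∪_; ∁; _⊆_; inside; outside)
open import Data.Fin.Subset.Properties
  using (∣⁅x⁆∣≡1; ∣p∣≤∣x∷p∣; ∣p∣≤n; ∣∁p∣≡n∸∣p∣; p⊂q⇒∣p∣<∣q∣; p⊆q⇒∣p∣≤∣q∣; q⊆p∪q;
         x∈⁅x⁆; x∈⁅y⁆⇒x≡y; x∈p∪q⁺; x∈p∪q⁻; x∉∁p⇒x∈p; x∈∁p⇒x∉p; x∉p⇒x∈∁p; _∈?_)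
open import Data.Product using (_,_; proj₁; proj₂; _×_; ∃-syntax; swap)
open import Data.Sum using (_⊎_; inj₁; inj₂; [_,_]′)
import Data.Sum as Sum
open import Data.Vec using (_∷_; [])
open import Function using (_∘_; Equivalence)
open import Relation.Nullary using (¬_; yes; no)
open import Relation.Nullary.Decidable using (_×-dec_; ¬?)
open import Relation.Unary using (Pred; Decidable)
open import Relation.Binary.PropositionalEquality

DividesMod : ℕ → ℕ → ℕ → Set
DividesMod N u v = ∃[ j ] ∃[ q ] j * u ≡ v + q * N

even-or-odd : ∀ t → (∃[ s ] t ≡ 2 * s) ⊎ (∃[ s ] t ≡ 1 + 2 * s)
even-or-odd zero = inj₁ (0 , refl)
even-or-odd (suc t) with even-or-odd t
... | inj₁ (s , refl) = inj₂ (s , refl)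
... | inj₂ (s , refl) = inj₁ (suc s , cong suc (sym (+-suc s (s + 0))))

InvertibleMod : ℕ → ℕ → Set
InvertibleMod N u = ∃[ x ] ∃[ t ] x * u ≡ 1 + t * N

-- Hensel lifting: if t is odd, x + P corrects the defect t * P, since t + (1 + 2w) is even.
invertibleMod-double : ∀ P w → InvertibleMod P (1 + 2 * w) → InvertibleMod (2 * P) (1 + 2 * w)
invertibleMod-double P w (x , t , x-inv) with even-or-odd t
... | inj₁ (s , refl) = x , s , trans x-inv (halve s P)
  where
  halve : ∀ s P → 1 + 2 * s * P ≡ 1 + s * (2 * P)
  halve = solve-∀
... | inj₂ (s , refl) = x + P , s + w + 1 , (begin
  (x + P) * (1 + 2 * w)                 ≡⟨ *-distribʳ-+ (1 + 2 * w) x P ⟩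
  x * (1 + 2 * w) + P * (1 + 2 * w)     ≡⟨ cong (_+ P * (1 + 2 * w)) x-inv ⟩
  1 + (1 + 2 * s) * P + P * (1 + 2 * w) ≡⟨ collect s w P ⟩
  1 + (s + w + 1) * (2 * P)             ∎)
  where
  open ≡-Reasoning
  collect : ∀ s w P → 1 + (1 + 2 * s) * P + P * (1 + 2 * w) ≡ 1 + (s + w + 1) * (2 * P)
  collect = solve-∀

odd-invertibleMod-2^ : ∀ r w → InvertibleMod (2 ^ r) (1 + 2 * w)
odd-invertibleMod-2^ zero    w = 1 , 2 * w , trans (*-identityˡ _) (cong (1 +_) (sym (*-identityʳ _)))
odd-invertibleMod-2^ (suc r) w = invertibleMod-double (2 ^ r) w (odd-invertibleMod-2^ r w)

invertible⇒dividesMod : ∀ N u v → InvertibleMod N u → DividesMod N u v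
invertible⇒dividesMod N u v (x , t , x-inv) = v * x , v * t , (begin
  v * x * u       ≡⟨ *-assoc v x u ⟩
  v * (x * u)     ≡⟨ cong (v *_) x-inv ⟩
  v * (1 + t * N) ≡⟨ expand v t N ⟩
  v + v * t * N   ∎)
  where
  open ≡-Reasoning
  expand : ∀ v t N → v * (1 + t * N) ≡ v + v * t * N
  expand = solve-∀

dividesMod-double : ∀ {u v N} → DividesMod N u v → DividesMod (2 * N) (2 * u) (2 * v)
dividesMod-double {u} {v} {N} (j , q , eq) = j , q , (begin
  j * (2 * u)     ≡⟨ *-comm j (2 * u) ⟩
  2 * u * j       ≡⟨ *-assoc 2 u j ⟩
  2 * (u * j)     ≡⟨ cong (2 *_) (trans (*-comm u j) eq) ⟩
  2 * (v + q * N) ≡⟨ distribute v q N ⟩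
  2 * v + q * (2 * N) ∎)
  where
  open ≡-Reasoning
  distribute : ∀ v q N → 2 * (v + q * N) ≡ 2 * v + q * (2 * N)
  distribute = solve-∀

-- Modulo 2^r, an odd number divides everything; two even numbers are compared after halving.
dividesMod-2^-total : ∀ r u v → DividesMod (2 ^ r) u v ⊎ DividesMod (2 ^ r) v u
dividesMod-2^-total zero zero    v = inj₂ (0 , 0 , refl)
dividesMod-2^-total zero (suc u) v = inj₁ (v , v * u , trans (*-suc v u) (cong (v +_) (sym (*-identityʳ (v * u)))))
dividesMod-2^-total (suc r) u v with even-or-odd u | even-or-odd v
... | inj₂ (w , refl) | _ = inj₁ (invertible⇒dividesMod _ _ v (odd-invertibleMod-2^ (suc r) w))
... | inj₁ _ | inj₂ (w , refl) = inj₂ (invertible⇒dividesMod _ _ u (odd-invertibleMod-2^ (suc r) w))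
... | inj₁ (a , refl) | inj₁ (b , refl) = Sum.map dividesMod-double dividesMod-double (dividesMod-2^-total r a b)

module Distance {N : ℕ} (Adj : Fin N → Fin N → Set)
                (irreflexive : ∀ {u} → ¬ Adj u u)
                (symmetric : ∀ {u v} → Adj u v → Adj v u) where

  open Graph Adj

  snoc : ∀ {u v w k} → Walk u v k → Adj v w → Walk u w (suc k)
  snoc nil         a = cons a nil
  snoc (cons b ws) a = cons b (snoc ws a)

  reverse : ∀ {u v k} → Walk u v k → Walk v u k
  reverse nil         = nil
  reverse (cons a ws) = snoc (reverse ws) (symmetric a)

  dist-refl : ∀ {u} → Dist u u 0
  dist-refl = nil , λ _ _ → z≤n

  dist-0⇒≡ : ∀ {u v} → Dist u v 0 → u ≡ v
  dist-0⇒≡ (nil , _) = refl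

  dist-unique : ∀ {u v k k′} → Dist u v k → Dist u v k′ → k ≡ k′
  dist-unique (ws , k-min) (ws′ , k′-min) = ≤-antisym (k-min _ ws′) (k′-min _ ws)

  dist-sym : ∀ {u v k} → Dist u v k → Dist v u k
  dist-sym (ws , k-min) = reverse ws , λ j ws′ → k-min j (reverse ws′)

  dist-adjacent : ∀ {u v} → Adj u v → Dist u v 1
  dist-adjacent a = cons a nil , λ where
    zero    nil → ⊥-elim (irreflexive a)
    (suc _) _   → s≤s z≤n

  dist-two : ∀ {u v w} → u ≢ v → ¬ Adj u v → Adj u w → Adj w v → Dist u v 2
  dist-two u≢v ¬uv uw wv = cons uw (cons wv nil) , λ where
    zero          nil          → ⊥-elim (u≢v refl)
    (suc zero)    (cons a nil) → ⊥-elim (¬uv a)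
    (suc (suc _)) _            → s≤s (s≤s z≤n)

  sameRep-sym : ∀ {U v w} → SameRep U v w → SameRep U w v
  sameRep-sym same u u∈U k = swap (same u u∈U k)

  sameRep-member : ∀ {U v w} → v ∈ U → SameRep U v w → v ≡ w
  sameRep-member v∈U same = sym (dist-0⇒≡ (proj₁ (same _ v∈U 0) dist-refl))

  sameRep-distance : ∀ {U v w t d d′} → SameRep U v w → t ∈ U → Dist v t d → Dist w t d′ → d ≡ d′
  sameRep-distance same t∈U dv dw = dist-unique (proj₁ (same _ t∈U _) dv) dw

  equidistant⇒≡ : ∀ {U v w} → Resolving U → (∀ u → u ∈ U → ∃[ d ] Dist v u d × Dist w u d) → v ≡ w
  equidistant⇒≡ res equidistant = res _ _ λ u u∈U k →
    let d , dv , dw = equidistant u u∈U in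
    (λ dvk → subst (Dist _ u) (dist-unique dv dvk) dw) ,
    (λ dwk → subst (Dist _ u) (dist-unique dw dwk) dv)

∉∧∈⇒≢ : ∀ {n} {U : Subset n} {x u} → x ∉ U → u ∈ U → x ≢ u
∉∧∈⇒≢ x∉U u∈U refl = x∉U u∈U

representative : ∀ {N ℓ} {P : Pred (Fin N) ℓ} → Fin N → Decidable P →
                 (∀ {x y} → P x → P y → x ≡ y) → ∃[ a ] (∀ {x} → P x → x ≡ a)
representative default P? unique with any? P?
... | yes (a , Pa) = a , λ Px → unique Px Pa
... | no ¬∃P       = default , λ Px → ⊥-elim (¬∃P (_ , Px))

∣p∪q∣≤∣p∣+∣q∣ : ∀ {n} (p q : Subset n) → ∣ p ∪ q ∣ ≤ ∣ p ∣ + ∣ q ∣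
∣p∪q∣≤∣p∣+∣q∣ []            []            = z≤n
∣p∪q∣≤∣p∣+∣q∣ (outside ∷ p) (outside ∷ q) = ∣p∪q∣≤∣p∣+∣q∣ p q
∣p∪q∣≤∣p∣+∣q∣ (outside ∷ p) (inside ∷ q)  =
  ≤-trans (s≤s (∣p∪q∣≤∣p∣+∣q∣ p q)) (≤-reflexive (sym (+-suc ∣ p ∣ ∣ q ∣)))
∣p∪q∣≤∣p∣+∣q∣ (inside ∷ p)  (x ∷ q)       =
  s≤s (≤-trans (∣p∪q∣≤∣p∣+∣q∣ p q) (+-monoʳ-≤ ∣ p ∣ (∣p∣≤∣x∷p∣ x q)))

x∉p⇒∣p∣<∣⁅x⁆∪p∣ : ∀ {n} {x : Fin n} {p} → x ∉ p → ∣ p ∣ < ∣ ⁅ x ⁆ ∪ p ∣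
x∉p⇒∣p∣<∣⁅x⁆∪p∣ {x = x} {p} x∉p =
  p⊂q⇒∣p∣<∣q∣ (q⊆p∪q ⁅ x ⁆ p , x , x∈p∪q⁺ (inj₁ (x∈⁅x⁆ x)) , x∉p)

∈⁅x⁆∪⁅y⁆∪⁅z⁆⁻ : ∀ {n} {w x y z : Fin n} → w ∈ ⁅ x ⁆ ∪ ⁅ y ⁆ ∪ ⁅ z ⁆ → w ≡ x ⊎ w ≡ y ⊎ w ≡ z
∈⁅x⁆∪⁅y⁆∪⁅z⁆⁻ {x = x} {y} {z} w∈ =
  Sum.map (x∈⁅y⁆⇒x≡y x) (Sum.map (x∈⁅y⁆⇒x≡y y) (x∈⁅y⁆⇒x≡y z) ∘ x∈p∪q⁻ ⁅ y ⁆ ⁅ z ⁆) (x∈p∪q⁻ ⁅ x ⁆ _ w∈)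

∈⁅x⁆∪⁅y⁆∪⁅z⁆⁺ : ∀ {n} {w x y z : Fin n} → w ≡ x ⊎ w ≡ y ⊎ w ≡ z → w ∈ ⁅ x ⁆ ∪ ⁅ y ⁆ ∪ ⁅ z ⁆
∈⁅x⁆∪⁅y⁆∪⁅z⁆⁺ (inj₁ refl)        = x∈p∪q⁺ (inj₁ (x∈⁅x⁆ _))
∈⁅x⁆∪⁅y⁆∪⁅z⁆⁺ (inj₂ (inj₁ refl)) = x∈p∪q⁺ (inj₂ (x∈p∪q⁺ (inj₁ (x∈⁅x⁆ _))))
∈⁅x⁆∪⁅y⁆∪⁅z⁆⁺ (inj₂ (inj₂ refl)) = x∈p∪q⁺ (inj₂ (x∈p∪q⁺ (inj₂ (x∈⁅x⁆ _))))

∣⁅x⁆∪⁅y⁆∪⁅z⁆∣≤3 : ∀ {n} (x y z : Fin n) → ∣ ⁅ x ⁆ ∪ ⁅ y ⁆ ∪ ⁅ z ⁆ ∣ ≤ 3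
∣⁅x⁆∪⁅y⁆∪⁅z⁆∣≤3 x y z = begin
  ∣ ⁅ x ⁆ ∪ ⁅ y ⁆ ∪ ⁅ z ⁆ ∣             ≤⟨ ∣p∪q∣≤∣p∣+∣q∣ ⁅ x ⁆ _ ⟩
  ∣ ⁅ x ⁆ ∣ + ∣ ⁅ y ⁆ ∪ ⁅ z ⁆ ∣         ≤⟨ +-monoʳ-≤ ∣ ⁅ x ⁆ ∣ (∣p∪q∣≤∣p∣+∣q∣ ⁅ y ⁆ ⁅ z ⁆) ⟩
  ∣ ⁅ x ⁆ ∣ + (∣ ⁅ y ⁆ ∣ + ∣ ⁅ z ⁆ ∣)   ≡⟨ cong₂ _+_ (∣⁅x⁆∣≡1 x) (cong₂ _+_ (∣⁅x⁆∣≡1 y) (∣⁅x⁆∣≡1 z)) ⟩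
  3                                     ∎
  where open ≤-Reasoning

∣⁅x⁆∪⁅y⁆∪⁅z⁆∣≡3 : ∀ {n} {x y z : Fin n} → x ≢ y → x ≢ z → y ≢ z → ∣ ⁅ x ⁆ ∪ ⁅ y ⁆ ∪ ⁅ z ⁆ ∣ ≡ 3
∣⁅x⁆∪⁅y⁆∪⁅z⁆∣≡3 {x = x} {y} {z} x≢y x≢z y≢z = ≤-antisym (∣⁅x⁆∪⁅y⁆∪⁅z⁆∣≤3 x y z) (begin
  3                       ≡⟨ cong (2 +_) (sym (∣⁅x⁆∣≡1 z)) ⟩
  2 + ∣ ⁅ z ⁆ ∣           ≤⟨ s≤s (x∉p⇒∣p∣<∣⁅x⁆∪p∣ (y≢z ∘ x∈⁅y⁆⇒x≡y z)) ⟩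
  1 + ∣ ⁅ y ⁆ ∪ ⁅ z ⁆ ∣   ≤⟨ x∉p⇒∣p∣<∣⁅x⁆∪p∣ ([ x≢y ∘ x∈⁅y⁆⇒x≡y y , x≢z ∘ x∈⁅y⁆⇒x≡y z ]′ ∘ x∈p∪q⁻ ⁅ y ⁆ ⁅ z ⁆) ⟩
  ∣ ⁅ x ⁆ ∪ ⁅ y ⁆ ∪ ⁅ z ⁆ ∣       ∎)
  where open ≤-Reasoning

∣∁p∣≤k⇒n∸k≤∣p∣ : ∀ {n k} (p : Subset n) → ∣ ∁ p ∣ ≤ k → n ∸ k ≤ ∣ p ∣
∣∁p∣≤k⇒n∸k≤∣p∣ {n} {k} p ∣∁p∣≤k = begin
  n ∸ k             ≤⟨ ∸-monoʳ-≤ n ∣∁p∣≤k ⟩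
  n ∸ ∣ ∁ p ∣       ≡⟨ cong (n ∸_) (∣∁p∣≡n∸∣p∣ p) ⟩
  n ∸ (n ∸ ∣ p ∣)   ≡⟨ m∸[m∸n]≡n (∣p∣≤n p) ⟩
  ∣ p ∣             ∎
  where open ≤-Reasoning

<ᵇ-true : ∀ {a b} → a < b → (a <ᵇ b) ≡ true
<ᵇ-true = Equivalence.to T-≡ ∘ <⇒<ᵇ

<ᵇ-false : ∀ {a b} → b ≤ a → (a <ᵇ b) ≡ false
<ᵇ-false {a} {b} b≤a = ¬-not (≤⇒≯ b≤a ∘ <ᵇ⇒< a b ∘ Equivalence.from T-≡)

%-cong : ∀ x {d d′} .{{_ : NonZero d}} .{{_ : NonZero d′}} → d ≡ d′ → x % d ≡ x % d′
%-cong x refl = refl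

[m+n%d]%d≡[m+n]%d : ∀ a x d .{{_ : NonZero d}} → (a + x % d) % d ≡ (a + x) % d
[m+n%d]%d≡[m+n]%d a x d = begin
  (a + x % d) % d           ≡⟨ %-distribˡ-+ a (x % d) d ⟩
  (a % d + x % d % d) % d   ≡⟨ cong (λ c → (a % d + c) % d) (m%n%n≡m%n x d) ⟩
  (a % d + x % d) % d       ≡⟨ sym (%-distribˡ-+ a x d) ⟩
  (a + x) % d               ∎
  where open ≡-Reasoning

module PowerGraph (p : ℕ) where

  n m q : ℕ
  n = 3 + p
  m = 2 ^ (2 + p)
  q = 2 ^ (1 + p)

  m>0 : 0 < m
  m>0 = m^n>0 2 (2 + p)

  instance
    m-nonZero : NonZero m
    m-nonZero = >-nonZero m>0

  4≤m : 4 ≤ m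
  4≤m = ^-monoʳ-≤ 2 {2} {2 + p} (s≤s (s≤s z≤n))

  m<2m : m < 2 * m
  m<2m = m<m+n m (<-≤-trans m>0 (m≤m+n m 0))

  -- gyroOp reduces modulo suc (m ∸ 1), which equals m only propositionally.
  %-pred : ∀ x → x % suc (m ∸ 1) ≡ x % m
  %-pred x = %-cong x (suc-pred m)

  ⊕-PP : ∀ {i j} → i < m → j < m → gyroOp n i j ≡ (i + j) % m
  ⊕-PP i<m j<m rewrite <ᵇ-true i<m | <ᵇ-true j<m = %-pred _

  ⊕-HP : ∀ {i j} → m ≤ i → j < m → gyroOp n i j ≡ (i + (q ∸ 1) * j) % m + m
  ⊕-HP m≤i j<m rewrite <ᵇ-false m≤i | <ᵇ-true j<m = cong (_+ m) (%-pred _)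

  ⊕-HH : ∀ {i j} → m ≤ i → m ≤ j → gyroOp n i j ≡ ((q + 1) * i + (q ∸ 1) * j) % m
  ⊕-HH m≤i m≤j rewrite <ᵇ-false m≤i | <ᵇ-false m≤j = %-pred _

  h⊕h≡0 : ∀ {h} → m ≤ h → gyroOp n h h ≡ 0
  h⊕h≡0 {h} m≤h = begin
    gyroOp n h h                    ≡⟨ ⊕-HH m≤h m≤h ⟩
    ((q + 1) * h + (q ∸ 1) * h) % m ≡⟨ cong (_% m) (sym (*-distribʳ-+ h (q + 1) (q ∸ 1))) ⟩
    ((q + 1 + (q ∸ 1)) * h) % m     ≡⟨ cong (λ c → (c * h) % m) q+1+[q∸1]≡m ⟩
    (m * h) % m                     ≡⟨ cong (_% m) (*-comm m h) ⟩
    (h * m) % m                     ≡⟨ m*n%n≡0 h m ⟩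
    0                               ∎
    where
    open ≡-Reasoning
    q+1+[q∸1]≡m : q + 1 + (q ∸ 1) ≡ m
    q+1+[q∸1]≡m = begin
      q + 1 + (q ∸ 1)   ≡⟨ +-assoc q 1 (q ∸ 1) ⟩
      q + (1 + (q ∸ 1)) ≡⟨ cong (q +_) (m+[n∸m]≡n (m^n>0 2 (1 + p))) ⟩
      q + q             ≡⟨ cong (q +_) (sym (+-identityʳ q)) ⟩
      m                 ∎

  h⊕0≡h : ∀ {h} → m ≤ h → h < 2 * m → gyroOp n h 0 ≡ h
  h⊕0≡h {h} m≤h h<2m = begin
    gyroOp n h 0                ≡⟨ ⊕-HP m≤h m>0 ⟩
    (h + (q ∸ 1) * 0) % m + m   ≡⟨ cong (λ c → (h + c) % m + m) (*-zeroʳ (q ∸ 1)) ⟩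
    (h + 0) % m + m             ≡⟨ cong (λ c → c % m + m) (trans (+-identityʳ h) (sym (m∸n+n≡m m≤h))) ⟩
    (h ∸ m + m) % m + m         ≡⟨ cong (_+ m) ([m+n]%n≡m%n (h ∸ m) m) ⟩
    (h ∸ m) % m + m             ≡⟨ cong (_+ m) (m<n⇒m%n≡m h∸m<m) ⟩
    h ∸ m + m                   ≡⟨ m∸n+n≡m m≤h ⟩
    h                           ∎
    where
    open ≡-Reasoning
    h∸m<m : h ∸ m < m
    h∸m<m = m<n+o⇒m∸n<o h m (subst (h <_) (cong (m +_) (+-identityʳ m)) h<2m)

  pow-P : ∀ {a} → a < m → ∀ k → gyroPow n k a ≡ (suc k * a) % m
  pow-P {a} a<m zero    = trans (sym (m<n⇒m%n≡m a<m)) (cong (_% m) (sym (*-identityˡ a)))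
  pow-P {a} a<m (suc k) = begin
    gyroOp n a (gyroPow n k a)    ≡⟨ cong (gyroOp n a) (pow-P a<m k) ⟩
    gyroOp n a ((suc k * a) % m)  ≡⟨ ⊕-PP a<m (m%n<n (suc k * a) m) ⟩
    (a + (suc k * a) % m) % m     ≡⟨ [m+n%d]%d≡[m+n]%d a (suc k * a) m ⟩
    (a + suc k * a) % m           ∎
    where open ≡-Reasoning

  pow-H : ∀ {h} → m ≤ h → h < 2 * m → ∀ k → gyroPow n k h ≡ h ⊎ gyroPow n k h ≡ 0
  pow-H m≤h h<2m zero = inj₁ refl
  pow-H {h} m≤h h<2m (suc k) with pow-H m≤h h<2m k
  ... | inj₁ hᵏ≡h = inj₂ (trans (cong (gyroOp n h) hᵏ≡h) (h⊕h≡0 m≤h))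
  ... | inj₂ hᵏ≡0 = inj₁ (trans (cong (gyroOp n h) hᵏ≡0) (h⊕0≡h m≤h h<2m))

  pow-P-< : ∀ {a} → a < m → ∀ k → gyroPow n k a < m
  pow-P-< a<m k = subst (_< m) (sym (pow-P a<m k)) (m%n<n _ m)

  pow-in-H : ∀ {a} k → a < 2 * m → m ≤ gyroPow n k a → gyroPow n k a ≡ a
  pow-in-H {a} k a<2m m≤aᵏ with a <? m
  ... | yes a<m = ⊥-elim (<⇒≱ (pow-P-< a<m k) m≤aᵏ)
  ... | no a≮m with pow-H (≮⇒≥ a≮m) a<2m k
  ...   | inj₁ aᵏ≡a = aᵏ≡a
  ...   | inj₂ aᵏ≡0 = ⊥-elim (<⇒≱ m>0 (subst (m ≤_) aᵏ≡0 m≤aᵏ))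

  pow-reaches-0 : ∀ {a} → a < 2 * m → ∃[ k ] gyroPow n k a ≡ 0
  pow-reaches-0 {a} a<2m with a <? m
  ... | no a≮m  = 1 , h⊕h≡0 (≮⇒≥ a≮m)
  ... | yes a<m = m ∸ 1 , (begin
    gyroPow n (m ∸ 1) a    ≡⟨ pow-P a<m (m ∸ 1) ⟩
    (suc (m ∸ 1) * a) % m  ≡⟨ cong (λ c → (c * a) % m) (suc-pred m) ⟩
    (m * a) % m            ≡⟨ cong (_% m) (*-comm m a) ⟩
    (a * m) % m            ≡⟨ m*n%n≡0 a m ⟩
    0                      ∎)
    where open ≡-Reasoning

  dividesMod⇒pow-P : ∀ {a b} → a < m → 0 < b → b < m → DividesMod m a b → ∃[ k ] gyroPow n k a ≡ b
  dividesMod⇒pow-P a<m 0<b b<m (zero , c , 0≡b+cm) = ⊥-elim (<⇒≢ (<-≤-trans 0<b (m≤m+n _ _)) 0≡b+cm)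
  dividesMod⇒pow-P {a} {b} a<m 0<b b<m (suc k , c , eq) = k , (begin
    gyroPow n k a    ≡⟨ pow-P a<m k ⟩
    (suc k * a) % m  ≡⟨ cong (_% m) eq ⟩
    (b + c * m) % m  ≡⟨ [m+kn]%n≡m%n b c m ⟩
    b % m            ≡⟨ m<n⇒m%n≡m b<m ⟩
    b                ∎)
    where open ≡-Reasoning

  V : Set
  V = Fin (2 ^ n)

  open Graph (PowerAdj n)

  adj-irreflexive : ∀ {u} → ¬ PowerAdj n u u
  adj-irreflexive (u≢u , _) = u≢u refl

  adj-symmetric : ∀ {u v} → PowerAdj n u v → PowerAdj n v u
  adj-symmetric (u≢v , k , uv) = u≢v ∘ sym , k , Sum.swap uv

  open Distance (PowerAdj n) adj-irreflexive adj-symmetric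

  e : V
  e = fromℕ< (m^n>0 2 n)

  toℕ-e : toℕ e ≡ 0
  toℕ-e = toℕ-fromℕ< _

  IsP IsH : V → Set
  IsP v = 0 < toℕ v × toℕ v < m
  IsH v = m ≤ toℕ v

  IsP⇒≢e : ∀ {v} → IsP v → v ≢ e
  IsP⇒≢e (0<v , _) refl = <⇒≢ 0<v (sym toℕ-e)

  IsH⇒≢e : ∀ {v} → IsH v → v ≢ e
  IsH⇒≢e m≤v refl = <⇒≱ m>0 (subst (m ≤_) toℕ-e m≤v)

  IsP∧IsH⇒≢ : ∀ {u v} → IsP u → IsH v → u ≢ v
  IsP∧IsH⇒≢ (_ , u<m) m≤v refl = <⇒≱ u<m m≤v

  classify : ∀ v → v ≡ e ⊎ IsP v ⊎ IsH v
  classify v with toℕ v ≟ 0 | toℕ v <? m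
  ... | yes v≡0 | _       = inj₁ (toℕ-injective (trans v≡0 (sym toℕ-e)))
  ... | no v≢0  | yes v<m = inj₂ (inj₁ (n≢0⇒n>0 v≢0 , v<m))
  ... | no _    | no v≮m  = inj₂ (inj₂ (≮⇒≥ v≮m))

  e-adjacent : ∀ {v} → v ≢ e → PowerAdj n e v
  e-adjacent {v} v≢e =
    let k , vᵏ≡0 = pow-reaches-0 (toℕ<n v) in v≢e ∘ sym , k , inj₂ (trans vᵏ≡0 (sym toℕ-e))

  P-adjacent : ∀ {u v} → IsP u → IsP v → u ≢ v → PowerAdj n u v
  P-adjacent {u} {v} (0<u , u<m) (0<v , v<m) u≢v with dividesMod-2^-total (2 + p) (toℕ u) (toℕ v)
  ... | inj₁ u∣v = let k , uᵏ≡v = dividesMod⇒pow-P u<m 0<v v<m u∣v in u≢v , k , inj₁ uᵏ≡v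
  ... | inj₂ v∣u = let k , vᵏ≡u = dividesMod⇒pow-P v<m 0<u u<m v∣u in u≢v , k , inj₂ vᵏ≡u

  H-adjacent⇒≡e : ∀ {u v} → IsH u → PowerAdj n u v → v ≡ e
  H-adjacent⇒≡e {u} m≤u (u≢v , k , inj₁ uᵏ≡v) with pow-H m≤u (toℕ<n u) k
  ... | inj₁ uᵏ≡u = ⊥-elim (u≢v (toℕ-injective (trans (sym uᵏ≡u) uᵏ≡v)))
  ... | inj₂ uᵏ≡0 = toℕ-injective (trans (sym uᵏ≡v) (trans uᵏ≡0 (sym toℕ-e)))
  H-adjacent⇒≡e {u} {v} m≤u (u≢v , k , inj₂ vᵏ≡u) = ⊥-elim (u≢v (toℕ-injective
    (trans (sym vᵏ≡u) (pow-in-H k (toℕ<n v) (subst (m ≤_) (sym vᵏ≡u) m≤u)))))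

  dist-e : ∀ {v} → v ≢ e → Dist e v 1
  dist-e = dist-adjacent ∘ e-adjacent

  dist-P : ∀ {u v} → IsP u → IsP v → u ≢ v → Dist u v 1
  dist-P Pu Pv u≢v = dist-adjacent (P-adjacent Pu Pv u≢v)

  dist-H : ∀ {u v} → IsH u → v ≢ e → u ≢ v → Dist u v 2
  dist-H Hu v≢e u≢v =
    dist-two u≢v (v≢e ∘ H-adjacent⇒≡e Hu) (adj-symmetric (e-adjacent (IsH⇒≢e Hu))) (e-adjacent v≢e)

  P-twins : ∀ {U x y} → Resolving U → IsP x → IsP y → x ∉ U → y ∉ U → x ≡ y
  P-twins {U} {x} {y} res Px Py x∉U y∉U =
    equidistant⇒≡ res λ u u∈U → distances u (∉∧∈⇒≢ x∉U u∈U) (∉∧∈⇒≢ y∉U u∈U)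
    where
    distances : ∀ u → x ≢ u → y ≢ u → ∃[ d ] Dist x u d × Dist y u d
    distances u x≢u y≢u with classify u
    ... | inj₁ refl        = 1 , dist-sym (dist-e (IsP⇒≢e Px)) , dist-sym (dist-e (IsP⇒≢e Py))
    ... | inj₂ (inj₁ Pu)   = 1 , dist-P Px Pu x≢u , dist-P Py Pu y≢u
    ... | inj₂ (inj₂ Hu)   =
      2 , dist-sym (dist-H Hu (IsP⇒≢e Px) (x≢u ∘ sym)) , dist-sym (dist-H Hu (IsP⇒≢e Py) (y≢u ∘ sym))

  H-twins : ∀ {U x y} → Resolving U → IsH x → IsH y → x ∉ U → y ∉ U → x ≡ y
  H-twins {U} {x} {y} res Hx Hy x∉U y∉U =
    equidistant⇒≡ res λ u u∈U → distances u (∉∧∈⇒≢ x∉U u∈U) (∉∧∈⇒≢ y∉U u∈U)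
    where
    distances : ∀ u → x ≢ u → y ≢ u → ∃[ d ] Dist x u d × Dist y u d
    distances u x≢u y≢u with classify u
    ... | inj₁ refl   = 1 , dist-sym (dist-e (IsH⇒≢e Hx)) , dist-sym (dist-e (IsH⇒≢e Hy))
    ... | inj₂ Pu⊎Hu  = 2 , dist-H Hx u≢e x≢u , dist-H Hy u≢e y≢u
      where
      u≢e : u ≢ e
      u≢e = [ IsP⇒≢e , IsH⇒≢e ]′ Pu⊎Hu

  -- Outside a resolving set there is at most e, one vertex of P(n) ∖ {0} and one of H(n).
  resolving-size : ∀ U → Resolving U → 2 ^ n ∸ 3 ≤ ∣ U ∣
  resolving-size U res =
    ∣∁p∣≤k⇒n∸k≤∣p∣ U (≤-trans (p⊆q⇒∣p∣≤∣q∣ ∁U⊆) (∣⁅x⁆∪⁅y⁆∪⁅z⁆∣≤3 e (proj₁ P-outside) (proj₁ H-outside)))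
    where
    P-outside : ∃[ a ] (∀ {x} → IsP x × x ∉ U → x ≡ a)
    P-outside = representative e (λ x → ((0 <? toℕ x) ×-dec (toℕ x <? m)) ×-dec ¬? (x ∈? U))
                  λ (Px , x∉U) (Py , y∉U) → P-twins res Px Py x∉U y∉U
    H-outside : ∃[ a ] (∀ {x} → IsH x × x ∉ U → x ≡ a)
    H-outside = representative e (λ x → (m ≤? toℕ x) ×-dec ¬? (x ∈? U))
                  λ (Hx , x∉U) (Hy , y∉U) → H-twins res Hx Hy x∉U y∉U
    ∁U⊆ : ∁ U ⊆ ⁅ e ⁆ ∪ ⁅ proj₁ P-outside ⁆ ∪ ⁅ proj₁ H-outside ⁆
    ∁U⊆ {x} x∈∁U = ∈⁅x⁆∪⁅y⁆∪⁅z⁆⁺ (Sum.map₂ (Sum.map (λ Px → proj₂ P-outside (Px , x∉U))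
                                                    (λ Hx → proj₂ H-outside (Hx , x∉U))) (classify x))
      where
      x∉U : x ∉ U
      x∉U = x∈∁p⇒x∉p x∈∁U

  1<m : 1 < m
  1<m = ≤-trans (s≤s (s≤s z≤n)) 4≤m

  2<m : 2 < m
  2<m = ≤-trans (s≤s (s≤s (s≤s z≤n))) 4≤m

  m+1<2m : m + 1 < 2 * m
  m+1<2m = +-monoʳ-< m (<-≤-trans 1<m (m≤m+n m 0))

  t₁ t₂ a b : V
  t₁ = fromℕ< (<-trans 1<m m<2m)
  t₂ = fromℕ< m<2m
  a  = fromℕ< (<-trans 2<m m<2m)
  b  = fromℕ< m+1<2m

  IsP-t₁ : IsP t₁
  IsP-t₁ rewrite toℕ-fromℕ< (<-trans 1<m m<2m) = z<s , 1<m

  IsH-t₂ : IsH t₂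
  IsH-t₂ rewrite toℕ-fromℕ< m<2m = ≤-refl

  IsP-a : IsP a
  IsP-a rewrite toℕ-fromℕ< (<-trans 2<m m<2m) = z<s , 2<m

  IsH-b : IsH b
  IsH-b rewrite toℕ-fromℕ< m+1<2m = m≤m+n m 1

  a≢t₁ : a ≢ t₁
  a≢t₁ = (λ ()) ∘ fromℕ<-injective 2 1 _ _

  b≢t₂ : b ≢ t₂
  b≢t₂ = (λ m+1≡m → 1+n≢n (trans (+-comm 1 m) m+1≡m)) ∘ fromℕ<-injective (m + 1) m _ _

  exceptional : Fin 3 → V
  exceptional 0F = e
  exceptional 1F = a
  exceptional 2F = b

  signature : Fin 3 → ℕ × ℕ
  signature 0F = 1 , 1
  signature 1F = 1 , 2
  signature 2F = 2 , 2

  signature-injective : ∀ i j → signature i ≡ signature j → i ≡ j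
  signature-injective 0F 0F _  = refl
  signature-injective 0F 1F ()
  signature-injective 0F 2F ()
  signature-injective 1F 0F ()
  signature-injective 1F 1F _  = refl
  signature-injective 1F 2F ()
  signature-injective 2F 0F ()
  signature-injective 2F 1F ()
  signature-injective 2F 2F _  = refl

  dist-exceptional : ∀ i → Dist (exceptional i) t₁ (proj₁ (signature i))
                         × Dist (exceptional i) t₂ (proj₂ (signature i))
  dist-exceptional 0F = dist-e (IsP⇒≢e IsP-t₁) , dist-e (IsH⇒≢e IsH-t₂)
  dist-exceptional 1F = dist-P IsP-a IsP-t₁ a≢t₁
                      , dist-sym (dist-H IsH-t₂ (IsP⇒≢e IsP-a) (IsP∧IsH⇒≢ IsP-a IsH-t₂ ∘ sym))
  dist-exceptional 2F = dist-H IsH-b (IsP⇒≢e IsP-t₁) (IsP∧IsH⇒≢ IsP-t₁ IsH-b ∘ sym)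
                      , dist-H IsH-b (IsH⇒≢e IsH-t₂) b≢t₂

  S : Subset (2 ^ n)
  S = ⁅ e ⁆ ∪ ⁅ a ⁆ ∪ ⁅ b ⁆

  ∈S⇒exceptional : ∀ {x} → x ∈ S → ∃[ i ] x ≡ exceptional i
  ∈S⇒exceptional x∈S = [ (0F ,_) , [ (1F ,_) , (2F ,_) ]′ ]′ (∈⁅x⁆∪⁅y⁆∪⁅z⁆⁻ x∈S)

  t₁∈∁S : t₁ ∈ ∁ S
  t₁∈∁S = x∉p⇒x∈∁p ([ IsP⇒≢e IsP-t₁ , [ a≢t₁ ∘ sym , IsP∧IsH⇒≢ IsP-t₁ IsH-b ]′ ]′ ∘ ∈⁅x⁆∪⁅y⁆∪⁅z⁆⁻)

  t₂∈∁S : t₂ ∈ ∁ S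
  t₂∈∁S = x∉p⇒x∈∁p ([ IsH⇒≢e IsH-t₂ , [ IsP∧IsH⇒≢ IsP-a IsH-t₂ ∘ sym , b≢t₂ ∘ sym ]′ ]′ ∘ ∈⁅x⁆∪⁅y⁆∪⁅z⁆⁻)

  ∁S-resolving : Resolving (∁ S)
  ∁S-resolving v w same with v ∈? ∁ S | w ∈? ∁ S
  ... | yes v∈∁S | _        = sameRep-member v∈∁S same
  ... | no _     | yes w∈∁S = sym (sameRep-member w∈∁S (sameRep-sym same))
  ... | no v∉∁S  | no w∉∁S  with ∈S⇒exceptional (x∉∁p⇒x∈p v∉∁S) | ∈S⇒exceptional (x∉∁p⇒x∈p w∉∁S)
  ...   | i , refl | j , refl = cong exceptional (signature-injective i j (cong₂ _,_
          (sameRep-distance same t₁∈∁S (proj₁ (dist-exceptional i)) (proj₁ (dist-exceptional j)))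
          (sameRep-distance same t₂∈∁S (proj₂ (dist-exceptional i)) (proj₂ (dist-exceptional j)))))

  ∣∁S∣≡2^n∸3 : ∣ ∁ S ∣ ≡ 2 ^ n ∸ 3
  ∣∁S∣≡2^n∸3 = trans (∣∁p∣≡n∸∣p∣ S) (cong (2 ^ n ∸_)
    (∣⁅x⁆∪⁅y⁆∪⁅z⁆∣≡3 (IsP⇒≢e IsP-a ∘ sym) (IsH⇒≢e IsH-b ∘ sym) (IsP∧IsH⇒≢ IsP-a IsH-b)))

mainTheorem6 : (n : ℕ) → 3 ≤ n → Graph.MetricDim (PowerAdj n) (2 ^ n ∸ 3)
mainTheorem6 (suc (suc (suc p))) _ = (∁ S , ∁S-resolving , ∣∁S∣≡2^n∸3) , resolving-size
  where open PowerGraph p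
mainTheorem6 (suc zero)       (s≤s ())
mainTheorem6 (suc (suc zero)) (s≤s (s≤s ()))
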